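{- For all integers $k\ge 1$ and $n\ge 3$, $\chi_i(C_{3k}\Box C_n)\le 6$.
   Context: For a graph $G$, an incidence is a pair $(v,e)$ with $v\in V(G)$, $e\in E(G)$ and $v$ incident with $e$. Two incidences $(v,e)$ and $(w,f)$ are adjacent if $v=w$, or $e=f$, or the edge $vw$ equals $e$ or $f$. An incidence $k$-coloring of $G$ is a map from the set of incidences of $G$ to a set of $k$ colors such that adjacent incidences receive distinct colors; $\chi_i(G)$ is the least $k$ for which such a coloring exists. $C_n$ is the cycle on $n$ vertices and $\Box$ denotes the Cartesian product of graphs. -}

module Defs where

open import Data.Nat using (ℕ; zero; suc; _∸_)
open import Data.Fin using (Fin; toℕ)
open import Data.Product using (Σ; _×_; _,_; proj₁; proj₂)
open import Data.Sum using (_⊎_)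
open import Relation.Binary.PropositionalEquality using (_≡_; _≢_)

-- A simple graph given by its vertex type and (symmetric, loopless)
-- adjacency relation.  The edges are the unordered pairs {v,w} with Adj v w.
record Graph : Set₁ where
  field
    V   : Set
    Adj : V → V → Set
open Graph public

CycStep : (m : ℕ) → Fin m → Fin m → Set
CycStep m i j = (toℕ j ≡ suc (toℕ i)) ⊎ ((toℕ i ≡ m ∸ 1) × (toℕ j ≡ 0))

Cycle : ℕ → Graph
Cycle m = record { V = Fin m ; Adj = λ i j → CycStep m i j ⊎ CycStep m j i }

_□_ : Graph → Graph → Graph
G □ H = record
  { V   = V G × V H
  ; Adj = λ p q → ((proj₁ p ≡ proj₁ q) × Adj H (proj₂ p) (proj₂ q))
                ⊎ ((proj₂ p ≡ proj₂ q) × Adj G (proj₁ p) (proj₁ q)) }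

SameEdge : {A : Set} → A → A → A → A → Set
SameEdge a b c d = ((a ≡ c) × (b ≡ d)) ⊎ ((a ≡ d) × (b ≡ c))

-- An incidence (v, e) of G with e = vw is encoded by the ordered pair (v, w)
-- together with a proof that v ~ w.
Incidence : Graph → Set
Incidence G = Σ (V G × V G) (λ p → Adj G (proj₁ p) (proj₂ p))

IncAdj : (G : Graph) → Incidence G → Incidence G → Set
IncAdj G ((v , w) , _) ((x , y) , _) =
  (v ≡ x) ⊎ SameEdge v w x y ⊎ SameEdge v x v w ⊎ SameEdge v x x y

IsIncColoring : (G : Graph) (k : ℕ) → (Incidence G → Fin k) → Set
IsIncColoring G k c = ∀ (I J : Incidence G) → proj₁ I ≢ proj₁ J →
  IncAdj G I J → c I ≢ c J

χᵢ≤ : Graph → ℕ → Set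
χᵢ≤ G k = Σ (Incidence G → Fin k) (IsIncColoring G k)

-- Let P be the pentagon 0 1 2 3 4 with the chord {0 , 2}.  The graph C₃ □ P has
-- an incidence 6-coloring, checked below by evaluation.  P has non-backtracking
-- closed walks of lengths 3, 4 and 5 (the triangle 0 1 2, the square 0 2 3 4
-- and the pentagon), and appending turns around the triangle gives one of
-- every length n ≥ 3.  Such a walk is a locally injective homomorphism
-- C_n → P, just as winding k times around C₃ is one C_{3k} → C₃.  Their
-- product maps C_{3k} □ C_n locally injectively to C₃ □ P, and incidence
-- colorings pull back along locally injective homomorphisms.

module Submission where

open import Defs
open import Data.Nat using (ℕ; _≤_; _*_)
import Data.Nat as ℕ
open import Data.Nat.Base using (zero; suc; _+_; _∸_; _%_; s≤s; z≤n)
open import Data.Nat.DivMod using (result; _divMod_; _mod_)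
open import Data.Nat.Properties
  using (suc-injective; 0≢1+n; 1+n≢n; <-irrefl; +-identityʳ; *-comm; +-commutativeSemigroup)
open import Algebra.Properties.CommutativeSemigroup +-commutativeSemigroup using (x∙yz≈y∙xz)
open import Data.Fin using (Fin; zero; suc; toℕ; #_; _≟_)
open import Data.Fin.Properties using (toℕ-injective; toℕ<n; all?)
open import Data.Product using (_×_; _,_; proj₁; proj₂)
open import Data.Product.Properties using (≡-dec)
open import Data.Sum using (_⊎_; inj₁; inj₂; swap)
open import Data.Empty using (⊥-elim)
open import Function using (_∘_)
open import Relation.Binary.Definitions using (Symmetric; Decidable; DecidableEquality)
open import Relation.Nullary using (¬_; Dec)
open import Relation.Nullary.Decidable
  using (True; toWitness; map′; from-yes; ¬?; _×-dec_; _⊎-dec_; _→-dec_)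
open import Relation.Binary.PropositionalEquality
open ≡-Reasoning

private
  variable
    G H G₁ G₂ H₁ H₂ : Graph
    k m : ℕ

Loopless : Graph → Set
Loopless G = ∀ {v} → ¬ Adj G v v

adjacent⇒distinct : Loopless G → ∀ {v w} → Adj G v w → v ≢ w
adjacent⇒distinct loopless v~w refl = loopless v~w

record LocallyInjectiveHom (G H : Graph) : Set where
  field
    map                     : V G → V H
    preserves-adj           : ∀ {v w} → Adj G v w → Adj H (map v) (map w)
    injective-on-neighbours : ∀ {v w w′} → Adj G v w → Adj G v w′ → w ≢ w′ → map w ≢ map w′

hom-reflects-loopless : LocallyInjectiveHom G H → Loopless H → Loopless G
hom-reflects-loopless φ loopless = loopless ∘ LocallyInjectiveHom.preserves-adj φ

□-loopless : Loopless G → Loopless H → Loopless (G □ H)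
□-loopless loopless-G loopless-H (inj₁ (_ , loop)) = loopless-H loop
□-loopless loopless-G loopless-H (inj₂ (_ , loop)) = loopless-G loop

-- Neighbours (v , w′) and (v′ , w) of (v , w) are told apart by the first
-- coordinate, since v ~ v′; hence only one loopless factor is needed.
□-hom : Loopless H₁ → LocallyInjectiveHom G₁ H₁ → LocallyInjectiveHom G₂ H₂ →
        LocallyInjectiveHom (G₁ □ G₂) (H₁ □ H₂)
□-hom {H₁} {G₁} {G₂} {H₂} loopless-H₁ φ ψ = record
  { map                     = map
  ; preserves-adj           = preserves
  ; injective-on-neighbours = injective
  }
  where
  module φ = LocallyInjectiveHom φ
  module ψ = LocallyInjectiveHom ψ

  map : V (G₁ □ G₂) → V (H₁ □ H₂)
  map (v , w) = φ.map v , ψ.map w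

  preserves : ∀ {p q} → Adj (G₁ □ G₂) p q → Adj (H₁ □ H₂) (map p) (map q)
  preserves (inj₁ (refl , w~w′)) = inj₁ (refl , ψ.preserves-adj w~w′)
  preserves (inj₂ (refl , v~v′)) = inj₂ (refl , φ.preserves-adj v~v′)

  injective : ∀ {p q q′} → Adj (G₁ □ G₂) p q → Adj (G₁ □ G₂) p q′ → q ≢ q′ → map q ≢ map q′
  injective (inj₁ (refl , a)) (inj₁ (refl , b)) q≢q′ =
    ψ.injective-on-neighbours a b (q≢q′ ∘ cong (_ ,_)) ∘ cong proj₂
  injective (inj₂ (refl , a)) (inj₂ (refl , b)) q≢q′ =
    φ.injective-on-neighbours a b (q≢q′ ∘ cong (_, _)) ∘ cong proj₁
  injective (inj₁ (refl , _)) (inj₂ (refl , b)) _ =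
    adjacent⇒distinct {H₁} loopless-H₁ (φ.preserves-adj b) ∘ cong proj₁
  injective (inj₂ (refl , a)) (inj₁ (refl , _)) _ =
    adjacent⇒distinct {H₁} loopless-H₁ (φ.preserves-adj a) ∘ sym ∘ cong proj₁

-- An incidence (v , vw) is the arc v → w; adjacency of incidences then says
-- that the arcs share their tail or are consecutive (in either order).
record ArcColoring (G : Graph) (k : ℕ) : Set where
  field
    color                : V G → V G → Fin k
    tail-injective       : ∀ {u v w} → Adj G u v → Adj G u w → v ≢ w → color u v ≢ color u w
    consecutive-distinct : ∀ {u v w} → Adj G u v → Adj G v w → color u v ≢ color v w

arcColoring⇒χᵢ≤ : Loopless G → ArcColoring G k → χᵢ≤ G k
arcColoring⇒χᵢ≤ {G} {k} loopless c = (λ ((v , w) , _) → color v w) , proper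
  where
  open ArcColoring c

  proper : IsIncColoring G k (λ ((v , w) , _) → color v w)
  proper ((v , w) , v~w) ((.v , y) , v~y) ≢ (inj₁ refl) =
    tail-injective v~w v~y (≢ ∘ cong (v ,_))
  proper _ _ ≢ (inj₂ (inj₁ (inj₁ (refl , refl)))) = ⊥-elim (≢ refl)
  proper ((v , w) , v~w) ((.w , .v) , w~v) _ (inj₂ (inj₁ (inj₂ (refl , refl)))) =
    consecutive-distinct v~w w~v
  proper ((v , w) , v~w) ((.w , y) , w~y) _ (inj₂ (inj₂ (inj₁ (inj₁ (_ , refl))))) =
    consecutive-distinct v~w w~y
  proper ((v , .v) , v~v) _ _ (inj₂ (inj₂ (inj₁ (inj₂ (refl , refl))))) = ⊥-elim (loopless v~v)
  proper _ ((v , .v) , v~v) _ (inj₂ (inj₂ (inj₂ (inj₁ (refl , refl))))) = ⊥-elim (loopless v~v)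
  proper ((v , w) , v~w) ((x , .v) , x~v) _ (inj₂ (inj₂ (inj₂ (inj₂ (refl , _))))) =
    consecutive-distinct x~v v~w ∘ sym

pullback : LocallyInjectiveHom G H → ArcColoring H k → ArcColoring G k
pullback φ c = record
  { color                = λ v w → color (map v) (map w)
  ; tail-injective       = λ u~v u~w v≢w →
      tail-injective (preserves-adj u~v) (preserves-adj u~w) (injective-on-neighbours u~v u~w v≢w)
  ; consecutive-distinct = λ u~v v~w → consecutive-distinct (preserves-adj u~v) (preserves-adj v~w)
  }
  where
  open LocallyInjectiveHom φ
  open ArcColoring c

toℕ-last : (i : Fin m) → toℕ i ≡ m ∸ 1 → suc (toℕ i) ≡ m
toℕ-last {suc m} _ = cong suc

cycStep-functional : ∀ {i j j′ : Fin m} → CycStep m i j → CycStep m i j′ → j ≡ j′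
cycStep-functional (inj₁ j≡1+i) (inj₁ j′≡1+i) = toℕ-injective (trans j≡1+i (sym j′≡1+i))
cycStep-functional (inj₂ (_ , j≡0)) (inj₂ (_ , j′≡0)) = toℕ-injective (trans j≡0 (sym j′≡0))
cycStep-functional {j = j} (inj₁ j≡1+i) (inj₂ (i≡last , _)) =
  ⊥-elim (<-irrefl (trans j≡1+i (toℕ-last _ i≡last)) (toℕ<n j))
cycStep-functional {j′ = j′} (inj₂ (i≡last , _)) (inj₁ j′≡1+i) =
  ⊥-elim (<-irrefl (trans j′≡1+i (toℕ-last _ i≡last)) (toℕ<n j′))

cycStep-injective : ∀ {i i′ j : Fin m} → CycStep m i j → CycStep m i′ j → i ≡ i′
cycStep-injective (inj₁ j≡1+i) (inj₁ j≡1+i′) =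
  toℕ-injective (suc-injective (trans (sym j≡1+i) j≡1+i′))
cycStep-injective (inj₂ (i≡last , _)) (inj₂ (i′≡last , _)) =
  toℕ-injective (trans i≡last (sym i′≡last))
cycStep-injective (inj₁ j≡1+i) (inj₂ (_ , j≡0)) = ⊥-elim (0≢1+n (trans (sym j≡0) j≡1+i))
cycStep-injective (inj₂ (_ , j≡0)) (inj₁ j≡1+i′) = ⊥-elim (0≢1+n (trans (sym j≡0) j≡1+i′))

Cycle-symmetric : Symmetric (Adj (Cycle m))
Cycle-symmetric = swap

cycStep-irreflexive : 2 ≤ m → ∀ {i : Fin m} → ¬ CycStep m i i
cycStep-irreflexive _ (inj₁ i≡1+i) = 1+n≢n (sym i≡1+i)
cycStep-irreflexive {suc zero} (s≤s ()) (inj₂ _)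
cycStep-irreflexive {suc (suc _)} _ (inj₂ (i≡last , i≡0)) = 0≢1+n (trans (sym i≡0) i≡last)

Cycle-loopless : 2 ≤ m → Loopless (Cycle m)
Cycle-loopless 2≤m (inj₁ step) = cycStep-irreflexive 2≤m step
Cycle-loopless 2≤m (inj₂ step) = cycStep-irreflexive 2≤m step

-- The closed walk vertex 0 , … , vertex n, continued forever, so that both
-- non-backtracking and the wrap-around are stated for every index.
record NonBacktrackingClosedWalk (H : Graph) (n : ℕ) : Set where
  field
    vertex       : ℕ → V H
    step         : ∀ j → Adj H (vertex j) (vertex (suc j))
    no-backtrack : ∀ j → vertex j ≢ vertex (2 + j)
    closes       : vertex n ≡ vertex 0
    closes′      : vertex (suc n) ≡ vertex 1

module _ {H : Graph} {n : ℕ} (W : NonBacktrackingClosedWalk H n) where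
  open NonBacktrackingClosedWalk W

  private
    visit : Fin n → V H
    visit i = vertex (toℕ i)

    visited-next : ∀ {i j} → CycStep n i j → vertex (suc (toℕ i)) ≡ visit j
    visited-next (inj₁ j≡1+i) = cong vertex (sym j≡1+i)
    visited-next {i} {j} (inj₂ (i≡last , j≡0)) = begin
      vertex (suc (toℕ i)) ≡⟨ cong vertex (toℕ-last i i≡last) ⟩
      vertex n             ≡⟨ closes ⟩
      vertex 0             ≡⟨ cong vertex (sym j≡0) ⟩
      visit j              ∎

    visited-next² : ∀ {i j} → CycStep n i j → vertex (2 + toℕ i) ≡ vertex (suc (toℕ j))
    visited-next² (inj₁ j≡1+i) = cong (vertex ∘ suc) (sym j≡1+i)
    visited-next² {i} {j} (inj₂ (i≡last , j≡0)) = begin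
      vertex (2 + toℕ i)   ≡⟨ cong (vertex ∘ suc) (toℕ-last i i≡last) ⟩
      vertex (suc n)       ≡⟨ closes′ ⟩
      vertex 1             ≡⟨ cong (vertex ∘ suc) (sym j≡0) ⟩
      vertex (suc (toℕ j)) ∎

    steps-apart : ∀ {i j l} → CycStep n i j → CycStep n j l → visit i ≢ visit l
    steps-apart {i} i→j j→l i≡l =
      no-backtrack (toℕ i) (trans i≡l (sym (trans (visited-next² i→j) (visited-next j→l))))

  closedWalk⇒hom : Symmetric (Adj H) → LocallyInjectiveHom (Cycle n) H
  closedWalk⇒hom symmetric = record
    { map                     = visit
    ; preserves-adj           = preserves
    ; injective-on-neighbours = injective
    }
    where
    forward : ∀ {i j} → CycStep n i j → Adj H (visit i) (visit j)
    forward {i} i→j = subst (Adj H (visit i)) (visited-next i→j) (step (toℕ i))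

    preserves : ∀ {i j} → Adj (Cycle n) i j → Adj H (visit i) (visit j)
    preserves (inj₁ i→j) = forward i→j
    preserves (inj₂ j→i) = symmetric (forward j→i)

    injective : ∀ {i j j′} → Adj (Cycle n) i j → Adj (Cycle n) i j′ → j ≢ j′ → visit j ≢ visit j′
    injective (inj₁ i→j) (inj₁ i→j′) j≢j′ = ⊥-elim (j≢j′ (cycStep-functional i→j i→j′))
    injective (inj₂ j→i) (inj₂ j′→i) j≢j′ = ⊥-elim (j≢j′ (cycStep-injective j→i j′→i))
    injective (inj₁ i→j) (inj₂ j′→i) _    = steps-apart j′→i i→j ∘ sym
    injective (inj₂ j→i) (inj₁ i→j′) _    = steps-apart j→i i→j′

cyclic : {A : Set} → A → A → A → ℕ → A
cyclic a b c 0                   = a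
cyclic a b c 1                   = b
cyclic a b c 2                   = c
cyclic a b c (suc (suc (suc j))) = cyclic a b c j

cyclic-periodic : ∀ {A : Set} {a b c : A} q j → cyclic a b c (j + q * 3) ≡ cyclic a b c j
cyclic-periodic {a = a} {b} {c} zero j = cong (cyclic a b c) (+-identityʳ j)
cyclic-periodic {a = a} {b} {c} (suc q) j = begin
  cyclic a b c (j + (3 + q * 3)) ≡⟨ cong (cyclic a b c) (x∙yz≈y∙xz j 3 (q * 3)) ⟩
  cyclic a b c (3 + (j + q * 3)) ≡⟨⟩
  cyclic a b c (j + q * 3)       ≡⟨ cyclic-periodic q j ⟩
  cyclic a b c j                 ∎

module Triangle {G : Graph} (loopless : Loopless G) {a b c : V G}
         (a~b : Adj G a b) (b~c : Adj G b c) (c~a : Adj G c a) where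

  triangle-step : ∀ j → Adj G (cyclic a b c j) (cyclic a b c (suc j))
  triangle-step 0                   = a~b
  triangle-step 1                   = b~c
  triangle-step 2                   = c~a
  triangle-step (suc (suc (suc j))) = triangle-step j

  triangle-no-backtrack : ∀ j → cyclic a b c j ≢ cyclic a b c (2 + j)
  triangle-no-backtrack 0                   = adjacent⇒distinct {G} loopless c~a ∘ sym
  triangle-no-backtrack 1                   = adjacent⇒distinct {G} loopless a~b ∘ sym
  triangle-no-backtrack 2                   = adjacent⇒distinct {G} loopless b~c ∘ sym
  triangle-no-backtrack (suc (suc (suc j))) = triangle-no-backtrack j

  triangleWalk : ∀ q → NonBacktrackingClosedWalk G (q * 3)
  triangleWalk q = record
    { vertex       = cyclic a b c
    ; step         = triangle-step
    ; no-backtrack = triangle-no-backtrack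
    ; closes       = cyclic-periodic q 0
    ; closes′      = cyclic-periodic q 1
    }

addEdge : (G : Graph) → V G → V G → Graph
addEdge G a b = record { V = V G ; Adj = λ v w → Adj G v w ⊎ SameEdge v w a b }

addEdge-symmetric : ∀ {a b} → Symmetric (Adj G) → Symmetric (Adj (addEdge G a b))
addEdge-symmetric symmetric (inj₁ v~w)                = inj₁ (symmetric v~w)
addEdge-symmetric symmetric (inj₂ (inj₁ (v≡a , w≡b))) = inj₂ (inj₂ (w≡b , v≡a))
addEdge-symmetric symmetric (inj₂ (inj₂ (v≡b , w≡a))) = inj₂ (inj₁ (w≡a , v≡b))

addEdge-loopless : ∀ {a b} → Loopless G → a ≢ b → Loopless (addEdge G a b)
addEdge-loopless loopless a≢b (inj₁ v~v)                = loopless v~v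
addEdge-loopless loopless a≢b (inj₂ (inj₁ (v≡a , v≡b))) = a≢b (trans (sym v≡a) v≡b)
addEdge-loopless loopless a≢b (inj₂ (inj₂ (v≡b , v≡a))) = a≢b (trans (sym v≡a) v≡b)

Cycle-adj? : Decidable (Adj (Cycle m))
Cycle-adj? {m} i j = cycStep? i j ⊎-dec cycStep? j i
  where
  cycStep? : Decidable (CycStep m)
  cycStep? i j = toℕ j ℕ.≟ suc (toℕ i) ⊎-dec (toℕ i ℕ.≟ m ∸ 1 ×-dec toℕ j ℕ.≟ 0)

addEdge-adj? : ∀ {a b} → DecidableEquality (V G) → Decidable (Adj G) →
               Decidable (Adj (addEdge G a b))
addEdge-adj? {a = a} {b} _≟_ adj? v w = adj? v w ⊎-dec (v ≟ a ×-dec w ≟ b ⊎-dec v ≟ b ×-dec w ≟ a)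

□-adj? : DecidableEquality (V G) → DecidableEquality (V H) → Decidable (Adj G) → Decidable (Adj H) →
         Decidable (Adj (G □ H))
□-adj? _≟G_ _≟H_ adj?G adj?H (v , w) (v′ , w′) =
  v ≟G v′ ×-dec adj?H w w′ ⊎-dec w ≟H w′ ×-dec adj?G v v′

all-pairs? : ∀ {m n} {P : Fin m × Fin n → Set} → (∀ v → Dec (P v)) → Dec (∀ v → P v)
all-pairs? P? =
  map′ (λ ∀P (i , j) → ∀P i j) (λ ∀P i j → ∀P (i , j)) (all? λ i → all? λ j → P? (i , j))

ChordedPentagon : Graph
ChordedPentagon = addEdge (Cycle 5) (# 0) (# 2)

ChordedPentagon-adj? : Decidable (Adj ChordedPentagon)
ChordedPentagon-adj? = addEdge-adj? {Cycle 5} _≟_ Cycle-adj?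

edge : (s t : Fin 5) → {True (ChordedPentagon-adj? s t)} → Adj ChordedPentagon s t
edge s t {s~t} = toWitness s~t

Cycle₃□ChordedPentagon : Graph
Cycle₃□ChordedPentagon = Cycle 3 □ ChordedPentagon

Cycle₃-loopless : Loopless (Cycle 3)
Cycle₃-loopless = Cycle-loopless (s≤s (s≤s z≤n))

ChordedPentagon-loopless : Loopless ChordedPentagon
ChordedPentagon-loopless = addEdge-loopless {Cycle 5} (Cycle-loopless (s≤s (s≤s z≤n))) λ ()

Cycle₃□ChordedPentagon-loopless : Loopless Cycle₃□ChordedPentagon
Cycle₃□ChordedPentagon-loopless =
  □-loopless {Cycle 3} {ChordedPentagon} Cycle₃-loopless ChordedPentagon-loopless

-- Rotating C₃ by one step while adding 2 to every color preserves the coloring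
-- arcColor, so it is given by the arcs leaving (0 , s): layer₀-color d s t is
-- the color of the arc (0 , s) → (d , t).  In arcColor, (b + 2a) % 3 is b − a.
layer₀-color : ℕ → ℕ → ℕ → ℕ
layer₀-color 0 0 1 = 1
layer₀-color 0 0 2 = 3
layer₀-color 0 0 4 = 5
layer₀-color 0 1 0 = 4
layer₀-color 0 1 2 = 3
layer₀-color 0 2 0 = 4
layer₀-color 0 2 1 = 0
layer₀-color 0 2 3 = 2
layer₀-color 0 3 2 = 3
layer₀-color 0 3 4 = 5
layer₀-color 0 4 0 = 4
layer₀-color 0 4 3 = 2
layer₀-color 1 0 _ = 0
layer₀-color 1 1 _ = 2
layer₀-color 1 2 _ = 5
layer₀-color 1 3 _ = 4
layer₀-color 1 4 _ = 1
layer₀-color 2 0 _ = 2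
layer₀-color 2 1 _ = 5
layer₀-color 2 2 _ = 1
layer₀-color 2 3 _ = 0
layer₀-color 2 4 _ = 3
layer₀-color _ _ _ = 0

arcColor : V Cycle₃□ChordedPentagon → V Cycle₃□ChordedPentagon → Fin 6
arcColor (a , s) (b , t) =
  (layer₀-color ((toℕ b + 2 * toℕ a) % 3) (toℕ s) (toℕ t) + 2 * toℕ a) mod 6

Cycle₃□ChordedPentagon-arcColoring : ArcColoring Cycle₃□ChordedPentagon 6
Cycle₃□ChordedPentagon-arcColoring = record
  { color                = arcColor
  ; tail-injective       = λ {u v w} → from-yes tail-injective? u v w
  ; consecutive-distinct = λ {u v w} → from-yes consecutive-distinct? u v w
  }
  where
  _~_ : V Cycle₃□ChordedPentagon → V Cycle₃□ChordedPentagon → Set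
  _~_ = Adj Cycle₃□ChordedPentagon

  _≟V_ : DecidableEquality (V Cycle₃□ChordedPentagon)
  _≟V_ = ≡-dec _≟_ _≟_

  adj? : Decidable _~_
  adj? = □-adj? {Cycle 3} {ChordedPentagon} _≟_ _≟_ Cycle-adj? ChordedPentagon-adj?

  tail-injective? : Dec (∀ u v w → u ~ v → u ~ w → v ≢ w → arcColor u v ≢ arcColor u w)
  tail-injective? = all-pairs? λ u → all-pairs? λ v → all-pairs? λ w →
    adj? u v →-dec adj? u w →-dec ¬? (v ≟V w) →-dec ¬? (arcColor u v ≟ arcColor u w)

  consecutive-distinct? : Dec (∀ u v w → u ~ v → v ~ w → arcColor u v ≢ arcColor v w)
  consecutive-distinct? = all-pairs? λ u → all-pairs? λ v → all-pairs? λ w →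
    adj? u v →-dec adj? v w →-dec ¬? (arcColor u v ≟ arcColor v w)

hom⇒χᵢ≤6 : LocallyInjectiveHom G Cycle₃□ChordedPentagon → χᵢ≤ G 6
hom⇒χᵢ≤6 φ = arcColoring⇒χᵢ≤ (hom-reflects-loopless φ Cycle₃□ChordedPentagon-loopless)
                            (pullback φ Cycle₃□ChordedPentagon-arcColoring)

windingWalk : ∀ k → NonBacktrackingClosedWalk (Cycle 3) (k * 3)
windingWalk = Triangle.triangleWalk {Cycle 3} Cycle₃-loopless
  (inj₁ (inj₁ refl)) (inj₁ (inj₁ refl)) (inj₁ (inj₂ (refl , refl)))

module Triangle₀₁₂ = Triangle {ChordedPentagon} ChordedPentagon-loopless
  (edge (# 0) (# 1)) (edge (# 1) (# 2)) (edge (# 2) (# 0))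
module Triangle₀₂₁ = Triangle {ChordedPentagon} ChordedPentagon-loopless
  (edge (# 0) (# 2)) (edge (# 2) (# 1)) (edge (# 1) (# 0))

squareThenTriangles : ℕ → Fin 5
squareThenTriangles 0                         = # 0
squareThenTriangles 1                         = # 2
squareThenTriangles 2                         = # 3
squareThenTriangles 3                         = # 4
squareThenTriangles (suc (suc (suc (suc j)))) = cyclic (# 0) (# 2) (# 1) j

squareThenTrianglesWalk : ∀ q → NonBacktrackingClosedWalk ChordedPentagon (4 + q * 3)
squareThenTrianglesWalk q = record
  { vertex       = squareThenTriangles
  ; step         = step
  ; no-backtrack = no-backtrack
  ; closes       = cyclic-periodic q 0
  ; closes′      = cyclic-periodic q 1
  }
  where
  step : ∀ j → Adj ChordedPentagon (squareThenTriangles j) (squareThenTriangles (suc j))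
  step 0                         = edge (# 0) (# 2)
  step 1                         = edge (# 2) (# 3)
  step 2                         = edge (# 3) (# 4)
  step 3                         = edge (# 4) (# 0)
  step (suc (suc (suc (suc j)))) = Triangle₀₂₁.triangle-step j

  no-backtrack : ∀ j → squareThenTriangles j ≢ squareThenTriangles (2 + j)
  no-backtrack 0                         = λ ()
  no-backtrack 1                         = λ ()
  no-backtrack 2                         = λ ()
  no-backtrack 3                         = λ ()
  no-backtrack (suc (suc (suc (suc j)))) = Triangle₀₂₁.triangle-no-backtrack j

pentagonThenTriangles : ℕ → Fin 5
pentagonThenTriangles 0                               = # 0
pentagonThenTriangles 1                               = # 1
pentagonThenTriangles 2                               = # 2
pentagonThenTriangles 3                               = # 3
pentagonThenTriangles 4                               = # 4
pentagonThenTriangles (suc (suc (suc (suc (suc j))))) = cyclic (# 0) (# 1) (# 2) j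

pentagonThenTrianglesWalk : ∀ q → NonBacktrackingClosedWalk ChordedPentagon (5 + q * 3)
pentagonThenTrianglesWalk q = record
  { vertex       = pentagonThenTriangles
  ; step         = step
  ; no-backtrack = no-backtrack
  ; closes       = cyclic-periodic q 0
  ; closes′      = cyclic-periodic q 1
  }
  where
  step : ∀ j → Adj ChordedPentagon (pentagonThenTriangles j) (pentagonThenTriangles (suc j))
  step 0                               = edge (# 0) (# 1)
  step 1                               = edge (# 1) (# 2)
  step 2                               = edge (# 2) (# 3)
  step 3                               = edge (# 3) (# 4)
  step 4                               = edge (# 4) (# 0)
  step (suc (suc (suc (suc (suc j))))) = Triangle₀₁₂.triangle-step j

  no-backtrack : ∀ j → pentagonThenTriangles j ≢ pentagonThenTriangles (2 + j)
  no-backtrack 0                               = λ ()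
  no-backtrack 1                               = λ ()
  no-backtrack 2                               = λ ()
  no-backtrack 3                               = λ ()
  no-backtrack 4                               = λ ()
  no-backtrack (suc (suc (suc (suc (suc j))))) = Triangle₀₁₂.triangle-no-backtrack j

chordedPentagonWalk : ∀ x → NonBacktrackingClosedWalk ChordedPentagon (3 + x)
chordedPentagonWalk x with x divMod 3
... | result q zero                refl = Triangle₀₁₂.triangleWalk (suc q)
... | result q (suc zero)          refl = squareThenTrianglesWalk q
... | result q (suc (suc zero))    refl = pentagonThenTrianglesWalk q

lemma1 : (k n : ℕ) → 1 ≤ k → 3 ≤ n → χᵢ≤ (Cycle (3 * k) □ Cycle n) 6
lemma1 k (suc (suc (suc x))) _ _ rewrite *-comm 3 k =
  hom⇒χᵢ≤6 (□-hom {Cycle 3} Cycle₃-loopless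
    (closedWalk⇒hom (windingWalk k) Cycle-symmetric)
    (closedWalk⇒hom (chordedPentagonWalk x) (addEdge-symmetric {Cycle 5} Cycle-symmetric)))
lemma1 _ 1 _ (s≤s ())
lemma1 _ 2 _ (s≤s (s≤s ()))
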